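{- Let $k,d,n$ be nonnegative integers. If there is a $[k,d,n]$ PSF family in which the size of every set is at most $k+d$, then for every positive integer $r$, $\mathrm{CF}(B_{d(r+1)+kr})\le nr+d$.
   Context: An ordered set is a finite sequence of distinct elements of a ground set. A family $\mathcal F$ of ordered sets is prefix set-free (PSF) if for any two distinct members $A,B\in\mathcal F$, no prefix of $A$ equals $B$ as an (unordered) set. If the ground set has $n$ elements, every member of $\mathcal F$ has length at least $k$, and $|\mathcal F|\ge 2^d$, then $\mathcal F$ is called a $[k,d,n]$ PSF family. $B_m$ is the rooted complete binary tree with $m$ levels. For a graph $G$, a conflict-free coloring w.r.t. paths is a function $C\colon V(G)\to\{1,\dots,c\}$ such that for the vertex set of every path of $G$ (including single vertices) some color occurs exactly once on it; $\mathrm{CF}(G)$ is the minimum such $c$. -}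

module Defs where

open import Data.Nat using (ℕ; _≤_; _<_; _+_; _*_; _^_)
open import Data.Bool using (Bool)
open import Data.List using (List; []; _∷_; length; take; filter)
open import Data.List.Relation.Unary.All using (All)
open import Data.List.Relation.Unary.Unique.Propositional using (Unique)
open import Data.List.Relation.Unary.Linked using (Linked)
open import Data.List.Membership.Propositional using (_∈_)
open import Data.Fin using (Fin; _≟_)
open import Data.Product using (Σ; ∃; _×_; proj₁)
open import Data.Sum using (_⊎_)
open import Relation.Binary.PropositionalEquality using (_≡_; _≢_)
open import Relation.Nullary using (¬_)
open import Function.Bundles using (_⇔_)

SameSet : {n : ℕ} → List (Fin n) → List (Fin n) → Set
SameSet P Q = ∀ x → (x ∈ P) ⇔ (x ∈ Q)

IsOrderedSet : {n : ℕ} → List (Fin n) → Set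
IsOrderedSet A = Unique A

PrefixSetFree : {n : ℕ} → List (List (Fin n)) → Set
PrefixSetFree F =
  ∀ A B → A ∈ F → B ∈ F → A ≢ B → ∀ i → ¬ SameSet (take i A) B

IsPSFFamily : (k d n : ℕ) → List (List (Fin n)) → Set
IsPSFFamily k d n F =
  All IsOrderedSet F × Unique F × PrefixSetFree F ×
  All (λ A → k ≤ length A) F × (2 ^ d ≤ length F)

IsPath : {V : Set} → (V → V → Set) → List V → Set
IsPath Adj p = (p ≢ []) × Unique p × Linked Adj p

countColor : {V : Set} {c : ℕ} → (V → Fin c) → Fin c → List V → ℕ
countColor C col p = length (filter (λ v → C v ≟ col) p)

ConflictFree : {V : Set} → (V → V → Set) → (c : ℕ) → (V → Fin c) → Set
ConflictFree Adj c C =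
  ∀ p → IsPath Adj p → ∃ λ col → countColor C col p ≡ 1

CF≤ : {V : Set} → (V → V → Set) → ℕ → Set
CF≤ {V} Adj c = ∃ λ (C : V → Fin c) → ConflictFree Adj c C

-- The rooted complete binary tree B_m with m levels:
-- vertices are bit strings of length < m (root = []), and the children
-- of w are b ∷ w for b : Bool.

BVertex : ℕ → Set
BVertex m = Σ (List Bool) (λ w → length w < m)

BAdj : {m : ℕ} → BVertex m → BVertex m → Set
BAdj u v = (∃ λ b → proj₁ v ≡ b ∷ proj₁ u) ⊎ (∃ λ b → proj₁ u ≡ b ∷ proj₁ v)

CF-B≤ : ℕ → ℕ → Set
CF-B≤ m c = CF≤ (BAdj {m}) c

-- Levels of B_m are grouped into an initial block of d levels followed by r blocks of k + d levels.  In
-- block i ≥ 1 a vertex reads the d bits chosen on its root path just before the block starts as the index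
-- of a member A of F, and at offset j of the block it takes the colour (i, A[j]) if A has a j-th element and
-- the extra colour j − k otherwise; in block 0 every vertex takes an extra colour.  This uses n r + d colours.
-- A path consists of a top vertex t and two branches descending from it through different children of t.
-- If t has colour (i, e), this colour appears nowhere else on the path because A is an ordered set.  Otherwise
-- the extra colour of t is unique unless a branch runs through the whole member A of the next block; the other
-- branch then spells a prefix of a member B, and B ≠ A because the step below t is one of the address bits of
-- the next block.  As F is prefix set-free, some element occurs in exactly one of A and that prefix of B.

module Submission where

open import Defs

open import Data.Bool using (Bool; true; false)
open import Data.Empty using (⊥; ⊥-elim)
open import Data.Fin using (Fin; zero; suc; fromℕ<; toℕ; combine; join; splitAt)
import Data.Fin as Fin
open import Data.Fin.Properties using (toℕ-fromℕ<; fromℕ<-injective; combine-injective; splitAt-join)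
open import Data.List
  using (List; []; _∷_; _++_; _∷ʳ_; initLast; _∷ʳ′_; reverse; map; filter; length; take; drop; lookup; fromMaybe)
open import Data.List.Membership.Propositional using (_∈_; _∉_; find)
open import Data.List.Membership.Propositional.Properties using (∈-++⁺ˡ; ∈-++⁺ʳ; ∈-filter⁻; ∈-lookup)
import Data.List.Membership.DecPropositional as DecMembership
open import Data.List.Properties
  using (++-assoc; ∷-injectiveˡ; ∷-injectiveʳ; length-++; length-++-≤ʳ; length-drop; length-take; reverse-++;
         take++drop≡id; take-all; filter-++; filter-none; filter-accept; filter-reject; filter-≐)
open import Data.List.Relation.Binary.Permutation.Propositional.Properties using (↭-length; filter-↭; ↭-reverse)
open import Data.List.Relation.Unary.All using (All; []; _∷_; all?)
import Data.List.Relation.Unary.All as All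
open import Data.List.Relation.Unary.All.Properties using (¬Any⇒All¬; ¬All⇒Any¬)
open import Data.List.Relation.Unary.AllPairs using ([]; _∷_)
open import Data.List.Relation.Unary.Any using (here; there)
open import Data.List.Relation.Unary.Any.Properties using (reverse⁺)
open import Data.List.Relation.Unary.Linked using (Linked; []; _∷_)
import Data.List.Relation.Unary.Linked.Properties as Linked
open import Data.List.Relation.Unary.Unique.Propositional using (Unique)
import Data.List.Relation.Unary.Unique.Propositional.Properties as Unique
open import Data.Maybe using (Maybe; just; nothing)
open import Data.Nat
  using (ℕ; zero; suc; pred; _+_; _*_; _∸_; _^_; _≤_; _<_; _≟_; _<?_; _≤?_; z≤n; s≤s; s≤s⁻¹; NonZero)
open import Data.Nat.Divisibility using (n∣m*n)
open import Data.Nat.DivMod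
  using (_/_; _%_; m≡m%n+[m/n]*n; m%n<n; [m+kn]%n≡m%n; m<n⇒m%n≡m; +-distrib-/-∣ʳ; m<n⇒m/n≡0; m*n/n≡m;
         m<n*o⇒m/o<n)
open import Data.Nat.Properties
open import Data.Nat.Tactic.RingSolver using (solve-∀)
open import Data.Product using (∃; _×_; _,_; proj₁; proj₂)
open import Data.Product.Properties using () renaming (≡-dec to ×-≡-dec)
open import Data.Sum using (_⊎_; inj₁; inj₂)
open import Data.Sum.Properties using (inj₁-injective; inj₂-injective) renaming (≡-dec to ⊎-≡-dec)
open import Function using (case_of_)
open import Function.Bundles using (_⇔_; Equivalence; mk⇔)
open import Level using (0ℓ)
open import Relation.Binary.Definitions using (DecidableEquality)
open import Relation.Binary.PropositionalEquality hiding (J)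
open import Relation.Nullary using (¬_; Dec; yes; no)
open import Relation.Nullary.Decidable.Core using (¬¬-excluded-middle)
open import Relation.Unary using (Pred; Decidable; ∁)

module _ {A : Set} where

  nth : List A → ℕ → Maybe A
  nth []       _       = nothing
  nth (x ∷ _)  zero    = just x
  nth (_ ∷ xs) (suc j) = nth xs j

  nth-≥ : ∀ (xs : List A) {j} → length xs ≤ j → nth xs j ≡ nothing
  nth-≥ []       _          = refl
  nth-≥ (_ ∷ xs) (s≤s len≤) = nth-≥ xs len≤

  nth≡nothing⇒≥ : ∀ (xs : List A) j → nth xs j ≡ nothing → length xs ≤ j
  nth≡nothing⇒≥ []       j       _  = z≤n
  nth≡nothing⇒≥ (_ ∷ xs) (suc j) eq = s≤s (nth≡nothing⇒≥ xs j eq)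

  nth-< : ∀ (xs : List A) {j} → j < length xs → ∃ λ x → nth xs j ≡ just x
  nth-< (x ∷ xs) {zero}  _        = x , refl
  nth-< (x ∷ xs) {suc j} (s≤s j<) = nth-< xs j<

  nth-∈ : ∀ (xs : List A) j {x} → nth xs j ≡ just x → x ∈ xs
  nth-∈ (x ∷ xs) zero    refl = here refl
  nth-∈ (x ∷ xs) (suc j) eq   = there (nth-∈ xs j eq)

  nth-injective : ∀ {xs : List A} → Unique xs → ∀ i j {x} → nth xs i ≡ just x → nth xs j ≡ just x → i ≡ j
  nth-injective {_ ∷ _}  _          zero    zero    _    _    = refl
  nth-injective {_ ∷ xs} (x∉ ∷ _)   zero    (suc j) refl eqj  = ⊥-elim (All.lookup x∉ (nth-∈ xs j eqj) refl)
  nth-injective {_ ∷ xs} (x∉ ∷ _)   (suc i) zero    eqi  refl = ⊥-elim (All.lookup x∉ (nth-∈ xs i eqi) refl)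
  nth-injective {_ ∷ xs} (_ ∷ uniq) (suc i) (suc j) eqi  eqj  = cong suc (nth-injective uniq i j eqi eqj)

  take-suc-nth : ∀ (xs : List A) j → take (suc j) xs ≡ take j xs ++ fromMaybe (nth xs j)
  take-suc-nth []       zero    = refl
  take-suc-nth []       (suc j) = refl
  take-suc-nth (x ∷ xs) zero    = refl
  take-suc-nth (x ∷ xs) (suc j) = cong (x ∷_) (take-suc-nth xs j)

  lookup-injective : ∀ {xs : List A} → Unique xs → ∀ i j → lookup xs i ≡ lookup xs j → i ≡ j
  lookup-injective {_ ∷ _}  _          zero    zero    _  = refl
  lookup-injective {_ ∷ xs} (x∉ ∷ _)   zero    (suc j) eq =
    ⊥-elim (All.lookup x∉ (subst (_∈ xs) (sym eq) (∈-lookup j)) refl)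
  lookup-injective {_ ∷ xs} (x∉ ∷ _)   (suc i) zero    eq =
    ⊥-elim (All.lookup x∉ (subst (_∈ xs) eq (∈-lookup i)) refl)
  lookup-injective {_ ∷ xs} (_ ∷ uniq) (suc i) (suc j) eq = cong suc (lookup-injective uniq i j eq)

  -- On a vertex of the tree, takeLast q is its ancestor at level q.
  takeLast : ℕ → List A → List A
  takeLast q xs = drop (length xs ∸ q) xs

  drop-++ : ∀ (xs ys : List A) m → drop (length xs + m) (xs ++ ys) ≡ drop m ys
  drop-++ []       ys m = refl
  drop-++ (x ∷ xs) ys m = drop-++ xs ys m

  takeLast-++ : ∀ (xs ys : List A) {q} → q ≤ length ys → takeLast q (xs ++ ys) ≡ takeLast q ys
  takeLast-++ xs ys {q} q≤ = begin
    drop (length (xs ++ ys) ∸ q) (xs ++ ys)        ≡⟨ cong (λ l → drop (l ∸ q) (xs ++ ys)) (length-++ xs) ⟩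
    drop (length xs + length ys ∸ q) (xs ++ ys)    ≡⟨ cong (λ l → drop l (xs ++ ys)) (+-∸-assoc (length xs) q≤) ⟩
    drop (length xs + (length ys ∸ q)) (xs ++ ys)  ≡⟨ drop-++ xs ys (length ys ∸ q) ⟩
    takeLast q ys                                  ∎
    where open ≡-Reasoning

  length-takeLast : ∀ (xs : List A) {q} → q ≤ length xs → length (takeLast q xs) ≡ q
  length-takeLast xs {q} q≤ = trans (length-drop (length xs ∸ q) xs) (m∸[m∸n]≡n q≤)

  takeLast-length : ∀ (xs : List A) → takeLast (length xs) xs ≡ xs
  takeLast-length xs = cong (λ l → drop l xs) (n∸n≡0 (length xs))

  takeLast-takeLast : ∀ (xs : List A) {p q} → p ≤ q → q ≤ length xs → takeLast p (takeLast q xs) ≡ takeLast p xs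
  takeLast-takeLast xs {p} {q} p≤q q≤ = sym (begin
    takeLast p xs                                          ≡⟨ cong (takeLast p) (take++drop≡id (length xs ∸ q) xs) ⟨
    takeLast p (take (length xs ∸ q) xs ++ takeLast q xs)  ≡⟨ takeLast-++ _ (takeLast q xs) p≤length ⟩
    takeLast p (takeLast q xs)                             ∎)
    where
    open ≡-Reasoning
    p≤length : p ≤ length (takeLast q xs)
    p≤length = subst (p ≤_) (sym (length-takeLast xs q≤)) p≤q

  drop-takeLast : ∀ (xs : List A) {p q} → p ≤ q → q ≤ length xs → drop p (takeLast q xs) ≡ takeLast (q ∸ p) xs
  drop-takeLast xs {p} {q} p≤q q≤ = begin
    drop p (takeLast q xs)              ≡⟨ cong (λ l → drop l (takeLast q xs)) (m∸[m∸n]≡n p≤q) ⟨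
    drop (q ∸ (q ∸ p)) (takeLast q xs)  ≡⟨ cong (λ l → drop (l ∸ (q ∸ p)) (takeLast q xs)) (length-takeLast xs q≤) ⟨
    takeLast (q ∸ p) (takeLast q xs)    ≡⟨ takeLast-takeLast xs (m∸n≤m q p) q≤ ⟩
    takeLast (q ∸ p) xs                 ∎
    where open ≡-Reasoning

  takeLast-∷ʳ-++ : ∀ pre (c : A) ys → takeLast (suc (length ys)) ((pre ∷ʳ c) ++ ys) ≡ c ∷ ys
  takeLast-∷ʳ-++ pre c ys = begin
    takeLast (suc (length ys)) ((pre ∷ʳ c) ++ ys)  ≡⟨ cong (takeLast (suc (length ys))) (++-assoc pre (c ∷ []) ys) ⟩
    takeLast (suc (length ys)) (pre ++ c ∷ ys)     ≡⟨ takeLast-++ pre (c ∷ ys) ≤-refl ⟩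
    takeLast (length (c ∷ ys)) (c ∷ ys)            ≡⟨ takeLast-length (c ∷ ys) ⟩
    c ∷ ys                                         ∎
    where open ≡-Reasoning

count : {A : Set} {P : Pred A 0ℓ} → Decidable P → List A → ℕ
count P? xs = length (filter P? xs)

module _ {A : Set} {P : Pred A 0ℓ} (P? : Decidable P) where

  count-++ : ∀ xs ys → count P? (xs ++ ys) ≡ count P? xs + count P? ys
  count-++ xs ys = trans (cong length (filter-++ P? xs ys)) (length-++ (filter P? xs))

  count-reverse : ∀ xs → count P? (reverse xs) ≡ count P? xs
  count-reverse xs = ↭-length (filter-↭ P? (↭-reverse xs))

  count-none : ∀ {xs} → All (∁ P) xs → count P? xs ≡ 0
  count-none ¬Ps = cong length (filter-none P? ¬Ps)

  count≡1⇒witness : ∀ xs → count P? xs ≡ 1 → ∃ λ x → x ∈ xs × P x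
  count≡1⇒witness xs _ with filter P? xs in eq
  ... | x ∷ _ = x , ∈-filter⁻ P? (subst (x ∈_) (sym eq) (here refl))

count-map : {A B : Set} {P : Pred B 0ℓ} (P? : Decidable P) (f : A → B) (xs : List A) →
            count P? (map f xs) ≡ count (λ x → P? (f x)) xs
count-map P? f []       = refl
count-map P? f (x ∷ xs) with P? (f x)
... | yes _ = cong suc (count-map P? f xs)
... | no  _ = count-map P? f xs

module Occurrences {A : Set} (_≟_ : DecidableEquality A) where

  open DecMembership _≟_ using (_∈?_)

  occ : A → List A → ℕ
  occ a = count (a ≟_)

  occ-∉ : ∀ {a xs} → a ∉ xs → occ a xs ≡ 0
  occ-∉ {xs = xs} a∉ = count-none (_ ≟_) (¬Any⇒All¬ xs a∉)

  occ-∈ : ∀ {a xs} → Unique xs → a ∈ xs → occ a xs ≡ 1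
  occ-∈ {xs = x ∷ xs} (x∉ ∷ _) (here refl) =
    trans (cong length (filter-accept (x ≟_) refl)) (cong suc (count-none (x ≟_) x∉))
  occ-∈ {a} {x ∷ xs} (x∉ ∷ uniq) (there a∈) =
    trans (cong length (filter-reject (a ≟_) (λ { refl → All.lookup x∉ a∈ refl }))) (occ-∈ uniq a∈)

  occ-symmetricDifference : ∀ {xs ys} → Unique xs → Unique ys → ¬ (∀ a → a ∈ xs ⇔ a ∈ ys) →
                            ∃ λ a → occ a xs + occ a ys ≡ 1
  occ-symmetricDifference {xs} {ys} uxs uys xs≁ys with all? (_∈? ys) xs | all? (_∈? xs) ys
  ... | no xs⊈ys | _ = let a , a∈xs , a∉ys = find (¬All⇒Any¬ (_∈? ys) xs xs⊈ys) in
    a , cong₂ _+_ (occ-∈ uxs a∈xs) (occ-∉ a∉ys)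
  ... | yes _ | no ys⊈xs = let a , a∈ys , a∉xs = find (¬All⇒Any¬ (_∈? xs) ys ys⊈xs) in
    a , cong₂ _+_ (occ-∉ a∉xs) (occ-∈ uys a∈ys)
  ... | yes xs⊆ys | yes ys⊆xs = ⊥-elim (xs≁ys λ a → mk⇔ (All.lookup xs⊆ys) (All.lookup ys⊆xs))

fromBits : List Bool → ℕ
fromBits []           = 0
fromBits (false ∷ bs) = fromBits bs
fromBits (true ∷ bs)  = 2 ^ length bs + fromBits bs

fromBits-< : ∀ bs → fromBits bs < 2 ^ length bs
fromBits-< []           = s≤s z≤n
fromBits-< (false ∷ bs) = ≤-trans (fromBits-< bs) (m≤m+n (2 ^ length bs) _)
fromBits-< (true ∷ bs)  = subst (2 ^ length bs + fromBits bs <_) (cong (2 ^ length bs +_) (sym (+-identityʳ _)))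
                            (+-monoʳ-< (2 ^ length bs) (fromBits-< bs))

fromBits-injective : ∀ bs cs → length bs ≡ length cs → fromBits bs ≡ fromBits cs → bs ≡ cs
fromBits-injective []           []           _   _  = refl
fromBits-injective (false ∷ bs) (false ∷ cs) len eq = cong (false ∷_) (fromBits-injective bs cs (suc-injective len) eq)
fromBits-injective (true ∷ bs)  (true ∷ cs)  len eq =
  cong (true ∷_) (fromBits-injective bs cs (suc-injective len)
    (+-cancelˡ-≡ (2 ^ length bs) _ _ (trans eq (cong (λ l → 2 ^ l + fromBits cs) (sym (suc-injective len))))))
fromBits-injective (false ∷ bs) (true ∷ cs)  len eq = ⊥-elim (<⇒≱ (fromBits-< bs)
  (subst₂ _≤_ (cong (2 ^_) (sym (suc-injective len))) (sym eq) (m≤m+n (2 ^ length cs) _)))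
fromBits-injective (true ∷ bs)  (false ∷ cs) len eq = ⊥-elim (<⇒≱ (fromBits-< cs)
  (subst₂ _≤_ (cong (2 ^_) (suc-injective len)) eq (m≤m+n (2 ^ length bs) _)))

divMod-unique : ∀ {m s i j} .{{_ : NonZero s}} → j < s → m ≡ j + i * s → m / s ≡ i × m % s ≡ j
divMod-unique {s = s} {i} {j} j<s refl =
  trans (+-distrib-/-∣ʳ j (n∣m*n i)) (cong₂ _+_ (m<n⇒m/n≡0 j<s) (m*n/n≡m i s)) ,
  trans ([m+kn]%n≡m%n j i s) (m<n⇒m%n≡m j<s)

-- Paths in the complete binary tree

Word : Set
Word = List Bool

Adjacent : Word → Word → Set
Adjacent u v = (∃ λ b → v ≡ b ∷ u) ⊎ (∃ λ b → u ≡ b ∷ v)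

wordPath : ∀ {m} {p : List (BVertex m)} → IsPath BAdj p → IsPath Adjacent (map proj₁ p)
wordPath {p = p} (p≢[] , uniq , linked) = map≢[] p p≢[] , Unique.map⁺ BVertex-≡ uniq , Linked.map⁺ linked
  where
  map≢[] : ∀ p → p ≢ [] → map proj₁ p ≢ []
  map≢[] []      p≢[] = ⊥-elim (p≢[] refl)
  map≢[] (_ ∷ _) _    ()
  BVertex-≡ : ∀ {u v : BVertex _} → proj₁ u ≡ proj₁ v → u ≡ v
  BVertex-≡ {w , w<} {.w , w<′} refl = cong (w ,_) (≤-irrelevant w< w<′)

-- branch xs t lists the vertices strictly below t on the way down to xs ++ t, deepest first.
branch : Word → Word → List Word
branch []       t = []
branch (b ∷ xs) t = (b ∷ xs ++ t) ∷ branch xs t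

branch-∷ʳ : ∀ ys b t → branch (ys ∷ʳ b) t ≡ branch ys (b ∷ t) ∷ʳ (b ∷ t)
branch-∷ʳ []       b t = refl
branch-∷ʳ (y ∷ ys) b t = cong₂ _∷_ (cong (y ∷_) (++-assoc ys (b ∷ []) t)) (branch-∷ʳ ys b t)

EndsWith : Bool → Word → Set
EndsWith c xs = ∃ λ pre → xs ≡ pre ∷ʳ c

¬EndsWith[] : ∀ {c} → ¬ EndsWith c []
¬EndsWith[] ([]    , ())
¬EndsWith[] (_ ∷ _ , ())

∷-∈-branch : ∀ {c ys} t → EndsWith c ys → c ∷ t ∈ branch ys t
∷-∈-branch t ([]      , refl) = here refl
∷-∈-branch t (_ ∷ pre , refl) = there (∷-∈-branch t (pre , refl))

-- The last bit of xs is the step from the top into the branch, so the branches leave the top through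
-- different children.
Diverge : Word → Word → Set
Diverge xs ys = ∀ {b c} → EndsWith b xs → EndsWith c ys → b ≢ c

Diverge-sym : ∀ {xs ys} → Diverge xs ys → Diverge ys xs
Diverge-sym diverge ys-ends xs-ends b≡c = diverge xs-ends ys-ends (sym b≡c)

record PathShape (ws : List Word) : Set where
  field
    top xs ys : Word
    shape     : ws ≡ branch xs top ++ top ∷ reverse (branch ys top)
    diverge   : Diverge xs ys

module _ {ws t xs ys} (eq : ws ≡ branch xs t ++ t ∷ reverse (branch ys t)) where

  top-∈ : t ∈ ws
  top-∈ = subst (t ∈_) (sym eq) (∈-++⁺ʳ (branch xs t) (here refl))

  left-∈ : ∀ {w} → w ∈ branch xs t → w ∈ ws
  left-∈ w∈ = subst (_ ∈_) (sym eq) (∈-++⁺ˡ w∈)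

  right-∈ : ∀ {w} → w ∈ branch ys t → w ∈ ws
  right-∈ w∈ = subst (_ ∈_) (sym eq) (∈-++⁺ʳ (branch xs t) (there (reverse⁺ w∈)))

pathShape : ∀ ws → IsPath Adjacent ws → PathShape ws
pathShape []           (ws≢[] , _) = ⊥-elim (ws≢[] refl)
pathShape (w ∷ [])     _           = record
  { top = w ; xs = [] ; ys = [] ; shape = refl ; diverge = λ e _ → ⊥-elim (¬EndsWith[] e) }
pathShape (u ∷ v ∷ ws) (_ , u∉ ∷ uniq , u~v ∷ linked) =
  extend (pathShape (v ∷ ws) ((λ ()) , uniq , linked)) u~v
  where
  repeated : u ∉ v ∷ ws
  repeated u∈ = All.lookup u∉ u∈ refl

  extend : PathShape (v ∷ ws) → Adjacent u v → PathShape (u ∷ v ∷ ws)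
  -- u is the parent of the top: it becomes the new top.
  extend record { top = t ; xs = [] ; ys = ys ; shape = eq } (inj₁ (b , refl)) = record
    { top = u ; xs = [] ; ys = ys ∷ʳ b ; shape = cong (u ∷_) shape′ ; diverge = λ e _ → ⊥-elim (¬EndsWith[] e) }
    where
    shape′ : (b ∷ u) ∷ ws ≡ reverse (branch (ys ∷ʳ b) u)
    shape′ = begin
      (b ∷ u) ∷ ws                            ≡⟨ eq ⟩
      t ∷ reverse (branch ys t)               ≡⟨ cong (λ t → t ∷ reverse (branch ys t)) (∷-injectiveˡ eq) ⟨
      (b ∷ u) ∷ reverse (branch ys (b ∷ u))   ≡⟨ reverse-++ (branch ys (b ∷ u)) ((b ∷ u) ∷ []) ⟨
      reverse (branch ys (b ∷ u) ∷ʳ (b ∷ u))  ≡⟨ cong reverse (branch-∷ʳ ys b u) ⟨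
      reverse (branch (ys ∷ʳ b) u)            ∎
      where open ≡-Reasoning
  -- u is a child of the top: the left branch starts.
  extend record { top = t ; xs = [] ; ys = ys ; shape = eq } (inj₂ (b , refl)) = record
    { top = t ; xs = b ∷ [] ; ys = ys ; shape = cong₂ _∷_ (cong (b ∷_) (∷-injectiveˡ eq)) eq ; diverge = diverge′ }
    where
    diverge′ : Diverge (b ∷ []) ys
    diverge′ ([] , refl) ys-ends refl = repeated (subst (λ z → b ∷ z ∈ v ∷ ws) (sym (∷-injectiveˡ eq))
                                          (right-∈ {xs = []} eq (∷-∈-branch t ys-ends)))
    diverge′ (_ ∷ [] , ()) _
    diverge′ (_ ∷ _ ∷ _ , ()) _
  -- u is the parent of v inside the left branch: it is already on the path.
  extend record { top = t ; xs = x ∷ xs ; ys = ys ; shape = eq } (inj₁ (b , v≡)) =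
    ⊥-elim (repeated (subst (_∈ v ∷ ws) (sym u≡) (parent-∈ xs refl)))
    where
    u≡ : u ≡ xs ++ t
    u≡ = ∷-injectiveʳ (trans (sym v≡) (∷-injectiveˡ eq))
    parent-∈ : ∀ zs → zs ≡ xs → zs ++ t ∈ v ∷ ws
    parent-∈ []      refl = top-∈ {xs = x ∷ xs} {ys = ys} eq
    parent-∈ (_ ∷ _) refl = left-∈ {xs = x ∷ xs} {ys = ys} eq (there (here refl))
  -- u is a child of v: the left branch grows.
  extend record { top = t ; xs = x ∷ xs ; ys = ys ; shape = eq ; diverge = diverge } (inj₂ (b , refl)) = record
    { top = t ; xs = b ∷ x ∷ xs ; ys = ys ; shape = cong₂ _∷_ (cong (b ∷_) (∷-injectiveˡ eq)) eq ; diverge = diverge′ }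
    where
    diverge′ : Diverge (b ∷ x ∷ xs) ys
    diverge′ ([]      , ()) _
    diverge′ (_ ∷ pre , e)  = diverge (pre , ∷-injectiveʳ e)

childTowards : ∀ zs t → length t < length (zs ++ t) →
               ∃ λ c → EndsWith c zs × takeLast (suc (length t)) (zs ++ t) ≡ c ∷ t
childTowards zs t t<zs++t with initLast zs
... | []        = ⊥-elim (<-irrefl refl t<zs++t)
... | pre ∷ʳ′ c = c , (pre , refl) , takeLast-∷ʳ-++ pre c t

-- w is an ancestor of v (or v itself).
infix 4 _≼_
_≼_ : Word → Word → Set
w ≼ v = ∃ λ pre → v ≡ pre ++ w

≼⇒length≤ : ∀ {w v} → w ≼ v → length w ≤ length v
≼⇒length≤ {w} (pre , refl) = length-++-≤ʳ w {pre}

takeLast-≼ : ∀ {w v q} → w ≼ v → q ≤ length w → takeLast q w ≡ takeLast q v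
takeLast-≼ (pre , refl) q≤ = sym (takeLast-++ pre _ q≤)

branch-vertices : ∀ xs t → All (λ w → t ≼ w × w ≼ xs ++ t × length t < length w) (branch xs t)
branch-vertices []       t = []
branch-vertices (b ∷ xs) t = ((b ∷ xs , refl) , ([] , refl) , s≤s (length-++-≤ʳ t {xs}))
  ∷ All.map (λ { (t≼w , (pre , eq) , t<w) → t≼w , (b ∷ pre , cong (b ∷_) eq) , t<w }) (branch-vertices xs t)

-- The colouring

¬SameSet[]-member : ∀ {n} {G : List (List (Fin n))} → Unique G → PrefixSetFree G → 2 ≤ length G →
                    ∀ {B} → B ∈ G → ¬ SameSet [] B
¬SameSet[]-member {G = _ ∷ []} _ _ (s≤s ())
¬SameSet[]-member {G = B₁ ∷ B₂ ∷ _} ((B₁≢B₂ ∷ _) ∷ _) psf _ {B} B∈G []≈B = ¬¬-excluded-middle {A = B₁ ≡ B} λ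
  { (yes refl)  → psf B₂ B (there (here refl)) B∈G (λ B₂≡B₁ → B₁≢B₂ (sym B₂≡B₁)) 0 []≈B
  ; (no  B₁≢B) → psf B₁ B (here refl) B∈G B₁≢B 0 []≈B }

conflictFree-transport : ∀ {V X : Set} {Adj : V → V → Set} {c} (_≟_ : DecidableEquality X)
                         (f : V → X) (C : V → Fin c) → (∀ u v → C u ≡ C v ⇔ f u ≡ f v) →
                         (∀ p → IsPath Adj p → ∃ λ x → count (λ v → f v ≟ x) p ≡ 1) →
                         ConflictFree Adj c C
conflictFree-transport _≟_ f C C≡⇔f≡ once p path with once p path
... | x , count≡1 with count≡1⇒witness (λ v → f v ≟ x) p count≡1
... | v₀ , _ , fv₀≡x =
  C v₀ , trans (cong length (filter-≐ (λ v → C v Fin.≟ C v₀) (λ v → f v ≟ x) (to , from) p)) count≡1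
  where
  to : ∀ {v} → C v ≡ C v₀ → f v ≡ x
  to Cv≡ = trans (Equivalence.to (C≡⇔f≡ _ v₀) Cv≡) fv₀≡x
  from : ∀ {v} → f v ≡ x → C v ≡ C v₀
  from fv≡ = Equivalence.from (C≡⇔f≡ _ v₀) (trans fv≡ (sym fv₀≡x))

module Construction
  (k d n : ℕ) (F : List (List (Fin n)))
  (F-ordered : All IsOrderedSet F) (F-unique : Unique F) (F-psf : PrefixSetFree F)
  (F-long : All (λ A → k ≤ length A) F) (F-short : All (λ A → length A ≤ k + d) F)
  (F-large : 2 ^ d ≤ length F)
  {{_ : NonZero (k + d)}}
  where

  s : ℕ
  s = k + d

  -- Level q lies in block (q + k) / s at offset (q + k) % s: block 0 is formed by the first d levels
  -- (offsets k, …, s − 1), every later block by s consecutive levels.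
  block offset : ℕ → ℕ
  block  q = (q + k) / s
  offset q = (q + k) % s

  offset<s : ∀ q → offset q < s
  offset<s q = m%n<n (q + k) s

  level-decomposition : ∀ q → q + k ≡ offset q + block q * s
  level-decomposition q = m≡m%n+[m/n]*n (q + k) s

  coordinates : ∀ {q i j} → j < s → q + k ≡ j + i * s → block q ≡ i × offset q ≡ j
  coordinates = divMod-unique

  blockStart : ℕ → ℕ
  blockStart zero    = 0
  blockStart (suc i) = d + i * s

  blockStart+k : ∀ i → blockStart (suc i) + k ≡ suc i * s
  blockStart+k i = lemma k d i
    where
    lemma : ∀ k d i → d + i * (k + d) + k ≡ (k + d) + i * (k + d)
    lemma = solve-∀

  blockStart≤level : ∀ q → blockStart (block q) ≤ q
  blockStart≤level q with block q | level-decomposition q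
  ... | zero  | _  = z≤n
  ... | suc i | eq = +-cancelʳ-≤ k _ q (begin
    blockStart (suc i) + k  ≡⟨ blockStart+k i ⟩
    suc i * s               ≤⟨ m≤n+m (suc i * s) (offset q) ⟩
    offset q + suc i * s    ≡⟨ eq ⟨
    q + k                   ∎)
    where open ≤-Reasoning

  address<length : ∀ α → fromBits (take d α) < length F
  address<length α = <-≤-trans (fromBits-< (take d α))
    (≤-trans (^-monoʳ-≤ 2 (≤-trans (≤-reflexive (length-take d α)) (m⊓n≤m d (length α)))) F-large)

  member : Word → List (Fin n)
  member α = lookup F (fromℕ< (address<length α))

  member-∈ : ∀ α → member α ∈ F
  member-∈ α = ∈-lookup (fromℕ< (address<length α))

  member-unique : ∀ α → Unique (member α)
  member-unique α = All.lookup F-ordered (member-∈ α)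

  member-long : ∀ α → k ≤ length (member α)
  member-long α = All.lookup F-long (member-∈ α)

  member-short : ∀ α → length (member α) ≤ s
  member-short α = All.lookup F-short (member-∈ α)

  member-injective : ∀ α β → d ≤ length α → d ≤ length β → member α ≡ member β → take d α ≡ take d β
  member-injective α β d≤α d≤β eq =
    fromBits-injective _ _ (trans (length-take-d d≤α) (sym (length-take-d d≤β))) (begin
      fromBits (take d α)              ≡⟨ toℕ-fromℕ< (address<length α) ⟨
      toℕ (fromℕ< (address<length α))  ≡⟨ cong toℕ (lookup-injective F-unique _ _ eq) ⟩
      toℕ (fromℕ< (address<length β))  ≡⟨ toℕ-fromℕ< (address<length β) ⟩
      fromBits (take d β)              ∎)
    where
    open ≡-Reasoning
    length-take-d : ∀ {γ : Word} → d ≤ length γ → length (take d γ) ≡ d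
    length-take-d {γ} d≤ = trans (length-take d γ) (m≤n⇒m⊓n≡m d≤)

  -- Block i ≥ 1 spells out the member of F selected by the d bits chosen just before the block starts.
  blockSet : ℕ → Word → List (Fin n)
  blockSet zero    w = []
  blockSet (suc i) w = member (takeLast (blockStart (suc i)) w)

  blockSet-unique : ∀ i w → Unique (blockSet i w)
  blockSet-unique zero    w = []
  blockSet-unique (suc i) w = member-unique _

  Colour : Set
  Colour = (ℕ × Fin n) ⊎ ℕ

  pattern element i a = inj₁ (i , a)
  pattern extra j     = inj₂ j

  _≟ᶜ_ : DecidableEquality Colour
  _≟ᶜ_ = ⊎-≡-dec (×-≡-dec _≟_ Fin._≟_) _≟_

  colourAt : ℕ → ℕ → Maybe (Fin n) → Colour
  colourAt i j (just a) = element i a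
  colourAt i j nothing  = extra (j ∸ k)

  colour : Word → Colour
  colour w = colourAt (block q) (offset q) (nth (blockSet (block q) w) (offset q))
    where q = length w

  colour-at : ∀ w {i j} → block (length w) ≡ i → offset (length w) ≡ j →
              colour w ≡ colourAt i j (nth (blockSet i w) j)
  colour-at w refl refl = refl

  colourAt≡element : ∀ i j m {i′ a} → colourAt i j m ≡ element i′ a → i ≡ i′ × m ≡ just a
  colourAt≡element i j (just _) refl = refl , refl

  colourAt≡extra : ∀ i j m {j′} → colourAt i j m ≡ extra j′ → j ∸ k ≡ j′
  colourAt≡extra i j nothing refl = refl

  cnt : Colour → List Word → ℕ
  cnt x = count (λ w → colour w ≟ᶜ x)

  cntPath : Colour → Word → Word → Word → ℕ
  cntPath x t xs ys = cnt x (branch xs t) + (cnt x (t ∷ []) + cnt x (branch ys t))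

  cnt-∷ : ∀ x w ws → cnt x (w ∷ ws) ≡ cnt x (w ∷ []) + cnt x ws
  cnt-∷ x w = count-++ (λ v → colour v ≟ᶜ x) (w ∷ [])

  cnt-[]≡ : ∀ x w → cnt x (w ∷ []) ≡ count (_≟ᶜ x) (colour w ∷ [])
  cnt-[]≡ x w = sym (count-map (_≟ᶜ x) colour (w ∷ []))

  cnt-[] : ∀ {x w} → colour w ≡ x → cnt x (w ∷ []) ≡ 1
  cnt-[] {x} colour≡ = cong length (filter-accept (λ w → colour w ≟ᶜ x) {xs = []} colour≡)

  cnt-none : ∀ {x ws} → All (λ w → colour w ≢ x) ws → cnt x ws ≡ 0
  cnt-none {x} = count-none (λ w → colour w ≟ᶜ x)

  open Occurrences (Fin._≟_ {n})

  level-injective : ∀ {q q′} → block q ≡ block q′ → offset q ≡ offset q′ → q ≡ q′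
  level-injective {q} {q′} b≡ o≡ = +-cancelʳ-≡ k q q′ (begin
    q + k                     ≡⟨ level-decomposition q ⟩
    offset q + block q * s    ≡⟨ cong₂ (λ j i → j + i * s) o≡ b≡ ⟩
    offset q′ + block q′ * s  ≡⟨ level-decomposition q′ ⟨
    q′ + k                    ∎)
    where open ≡-Reasoning

  blockSet-≼ : ∀ i {w v} → w ≼ v → blockStart i ≤ length w → blockSet i v ≡ blockSet i w
  blockSet-≼ zero    _   _ = refl
  blockSet-≼ (suc i) w≼v i≤w = cong member (sym (takeLast-≼ w≼v i≤w))

  count-element : ∀ i j m e → count (_≟ᶜ element i e) (colourAt i j m ∷ []) ≡ occ e (fromMaybe m)
  count-element i j nothing  e = refl
  count-element i j (just a) e with e Fin.≟ a
  ... | yes refl = cong length (filter-accept (_≟ᶜ element i e) {xs = []} refl)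
  ... | no  e≢a  =
    cong length (filter-reject (_≟ᶜ element i e) {x = element i a} {xs = []} λ { refl → e≢a refl })

  extra⇒k≤offset : ∀ {i q} w → block q ≡ i → nth (blockSet i w) (offset q) ≡ nothing → k ≤ offset q
  extra⇒k≤offset {zero}  {q} w block≡ _ = subst (k ≤_) q+k≡offset (m≤n+m k q)
    where
    q+k≡offset : q + k ≡ offset q
    q+k≡offset = trans (level-decomposition q) (trans (cong (λ i → offset q + i * s) block≡) (+-identityʳ (offset q)))
  extra⇒k≤offset {suc i} {q} w _ none =
    ≤-trans (member-long _) (nth≡nothing⇒≥ (blockSet (suc i) w) (offset q) none)

  module Top (t : Word) where

    h I J : ℕ
    h = length t
    I = block h
    J = offset h

    A : List (Fin n)
    A = blockSet I t

    topElement-absent : ∀ {e} → nth A J ≡ just e → ∀ xs → cnt (element I e) (branch xs t) ≡ 0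
    topElement-absent {e} A[J]≡e xs =
      cnt-none (All.map (λ (t≼w , _ , h<w) → notTopElement t≼w h<w) (branch-vertices xs t))
      where
      notTopElement : ∀ {w} → t ≼ w → h < length w → colour w ≢ element I e
      notTopElement {w} t≼w h<w colour≡ = <-irrefl (sym (level-injective block≡ (sym offset≡))) h<w
        where
        block≡ : block (length w) ≡ I
        block≡ = proj₁ (colourAt≡element _ _ _ colour≡)
        A[offset]≡e : nth A (offset (length w)) ≡ just e
        A[offset]≡e = subst (λ B → nth B (offset (length w)) ≡ just e)
          (trans (cong (λ i → blockSet i w) block≡) (blockSet-≼ I t≼w (blockStart≤level h)))
          (proj₂ (colourAt≡element _ _ _ colour≡))
        offset≡ : offset h ≡ offset (length w)
        offset≡ = nth-injective (blockSet-unique I t) _ _ A[J]≡e A[offset]≡e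

    module ExtraTop (A[J]≡nothing : nth A J ≡ nothing) where

      x₀ : Colour
      x₀ = extra (J ∸ k)

      colour-top : colour t ≡ x₀
      colour-top = cong (colourAt I J) A[J]≡nothing

      k≤J : k ≤ J
      k≤J = extra⇒k≤offset t refl A[J]≡nothing

      1≤d : 1 ≤ d
      1≤d = +-cancelˡ-≤ k 1 d (subst (_≤ s) (+-comm 1 k) (≤-<-trans k≤J (offset<s h)))

      D : ℕ
      D = blockStart (suc I)

      h<D : h < D
      h<D = +-cancelʳ-< k h D (begin-strict
        h + k        ≡⟨ level-decomposition h ⟩
        J + I * s    <⟨ +-monoˡ-< (I * s) (offset<s h) ⟩
        suc I * s    ≡⟨ blockStart+k I ⟨
        D + k        ∎)
        where open ≤-Reasoning

      I*s≤h : I * s ≤ h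
      I*s≤h = +-cancelʳ-≤ k (I * s) h (begin
        I * s + k    ≡⟨ +-comm (I * s) k ⟩
        k + I * s    ≤⟨ +-monoˡ-≤ (I * s) k≤J ⟩
        J + I * s    ≡⟨ level-decomposition h ⟨
        h + k        ∎)
        where open ≤-Reasoning

      coordinates-between : ∀ {q} → h < q → q < D → block q ≡ I × offset q ≡ J + (q ∸ h)
      coordinates-between {q} h<q q<D = coordinates offset<s′ q+k≡
        where
        rearrange : ∀ a b c → a + (b + c) ≡ (b + a) + c
        rearrange = solve-∀
        q+k≡ : q + k ≡ (J + (q ∸ h)) + I * s
        q+k≡ = begin
          q + k                  ≡⟨ cong (_+ k) (m∸n+n≡m (<⇒≤ h<q)) ⟨
          (q ∸ h) + h + k        ≡⟨ +-assoc (q ∸ h) h k ⟩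
          (q ∸ h) + (h + k)      ≡⟨ cong ((q ∸ h) +_) (level-decomposition h) ⟩
          (q ∸ h) + (J + I * s)  ≡⟨ rearrange (q ∸ h) J (I * s) ⟩
          (J + (q ∸ h)) + I * s  ∎
          where open ≡-Reasoning
        offset<s′ : J + (q ∸ h) < s
        offset<s′ = +-cancelʳ-< (I * s) _ s (subst₂ _<_ q+k≡ (blockStart+k I) (+-monoˡ-< k q<D))

      coordinates-next : ∀ {q} → D ≤ q → q < D + s → block q ≡ suc I × offset q ≡ q ∸ D
      coordinates-next {q} D≤q q<D+s = coordinates (m<n+o⇒m∸n<o q D q<D+s) (begin
        q + k                ≡⟨ cong (_+ k) (m∸n+n≡m D≤q) ⟨
        (q ∸ D) + D + k      ≡⟨ +-assoc (q ∸ D) D k ⟩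
        (q ∸ D) + (D + k)    ≡⟨ cong ((q ∸ D) +_) (blockStart+k I) ⟩
        (q ∸ D) + suc I * s  ∎)
        where open ≡-Reasoning

      block≡next⇒ : ∀ {q} → block q ≡ suc I → D ≤ q × q < D + s
      block≡next⇒ {q} block≡ = +-cancelʳ-≤ k D q (begin
          D + k                 ≡⟨ blockStart+k I ⟩
          suc I * s             ≤⟨ m≤n+m (suc I * s) (offset q) ⟩
          offset q + suc I * s  ≡⟨ q+k≡ ⟨
          q + k                 ∎) ,
        +-cancelʳ-< k q (D + s) (begin-strict
          q + k                 ≡⟨ q+k≡ ⟩
          offset q + suc I * s  <⟨ +-monoˡ-< (suc I * s) (offset<s q) ⟩
          s + suc I * s         ≡⟨ cong (s +_) (blockStart+k I) ⟨
          s + (D + k)           ≡⟨ +-assoc s D k ⟨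
          s + D + k             ≡⟨ cong (_+ k) (+-comm s D) ⟩
          D + s + k             ∎)
        where
        open ≤-Reasoning
        q+k≡ : q + k ≡ offset q + suc I * s
        q+k≡ = trans (level-decomposition q) (cong (λ i → offset q + i * s) block≡)

      nextMember : Word → List (Fin n)
      nextMember zs = member (takeLast D (zs ++ t))

      -- The branch towards zs ++ t runs through every level of the next block that carries an element.
      Long : Word → Set
      Long zs = D + length (nextMember zs) ≤ length (zs ++ t)

      outsideNext-count : ∀ e {w} → ¬ (D ≤ length w × length w < D + s) → cnt (element (suc I) e) (w ∷ []) ≡ 0
      outsideNext-count e {w} outside = cnt-none (notNext ∷ [])
        where
        notNext : colour w ≢ element (suc I) e
        notNext colour≡ = outside (block≡next⇒ (proj₁ (colourAt≡element _ _ _ colour≡)))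

      insideNext-count : ∀ e {w} → D ≤ length w →
                         cnt (element (suc I) e) (w ∷ []) ≡ occ e (fromMaybe (nth (member (takeLast D w)) (length w ∸ D)))
      insideNext-count e {w} D≤w with length w ∸ D <? s
      ... | yes j<s = begin
        cnt x (w ∷ [])                                 ≡⟨ cnt-[]≡ x w ⟩
        count (_≟ᶜ x) (colour w ∷ [])                  ≡⟨ cong (λ c → count (_≟ᶜ x) (c ∷ [])) (colour-at w block≡ offset≡) ⟩
        count (_≟ᶜ x) (colourAt (suc I) j (nth A′ j) ∷ [])  ≡⟨ count-element (suc I) j (nth A′ j) e ⟩
        occ e (fromMaybe (nth A′ j))                   ∎
        where
        open ≡-Reasoning
        x = element (suc I) e
        j = length w ∸ D
        A′ = member (takeLast D w)
        w<D+s : length w < D + s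
        w<D+s = subst (_< D + s) (m+[n∸m]≡n D≤w) (+-monoʳ-< D j<s)
        block≡ = proj₁ (coordinates-next D≤w w<D+s)
        offset≡ = proj₂ (coordinates-next D≤w w<D+s)
      ... | no  j≮s = trans (outsideNext-count e (λ (_ , w<D+s) → j≮s (m<n+o⇒m∸n<o (length w) D w<D+s)))
                            (sym (cong (λ m → occ e (fromMaybe m)) beyond))
        where
        beyond : nth (member (takeLast D w)) (length w ∸ D) ≡ nothing
        beyond = nth-≥ (member (takeLast D w)) (≤-trans (member-short _) (≮⇒≥ j≮s))

      nextElement-count : ∀ e α xs → (D ≤ length (xs ++ t) → takeLast D (xs ++ t) ≡ α) →
                          cnt (element (suc I) e) (branch xs t) ≡ occ e (take (suc (length (xs ++ t)) ∸ D) (member α))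
      nextElement-count e α []       _ = sym (cong (λ j → occ e (take j (member α))) (m≤n⇒m∸n≡0 h<D))
      nextElement-count e α (b ∷ xs) α≡ = step (q <? D)
        where
        x : Colour
        x = element (suc I) e
        w : Word
        w = b ∷ xs ++ t
        q : ℕ
        q = length w
        A′ : List (Fin n)
        A′ = member α
        α≡′ : D ≤ length (xs ++ t) → takeLast D (xs ++ t) ≡ α
        α≡′ D≤ = trans (sym (takeLast-++ (b ∷ []) (xs ++ t) D≤)) (α≡ (≤-trans D≤ (n≤1+n _)))

        step : Dec (q < D) → cnt x (branch (b ∷ xs) t) ≡ occ e (take (suc q ∸ D) A′)
        step (yes q<D) = begin
          cnt x (w ∷ branch xs t)               ≡⟨ cnt-∷ x w (branch xs t) ⟩
          cnt x (w ∷ []) + cnt x (branch xs t)  ≡⟨ cong₂ _+_ (outsideNext-count e (λ (D≤q , _) → <⇒≱ q<D D≤q))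
                                                            (nextElement-count e α xs α≡′) ⟩
          occ e (take (q ∸ D) A′)               ≡⟨ cong (λ j → occ e (take j A′)) (m≤n⇒m∸n≡0 (<⇒≤ q<D)) ⟩
          0                                     ≡⟨ cong (λ j → occ e (take j A′)) (m≤n⇒m∸n≡0 q<D) ⟨
          occ e (take (suc q ∸ D) A′)           ∎
          where open ≡-Reasoning
        step (no q≮D) = begin
          cnt x (w ∷ branch xs t)                           ≡⟨ cnt-∷ x w (branch xs t) ⟩
          cnt x (w ∷ []) + cnt x (branch xs t)              ≡⟨ cong₂ _+_ (insideNext-count e D≤q)
                                                                        (nextElement-count e α xs α≡′) ⟩
          occ e (fromMaybe (nth (member (takeLast D w)) j)) + occ e (take j A′)
            ≡⟨ cong (λ β → occ e (fromMaybe (nth (member β) j)) + occ e (take j A′)) (α≡ D≤q) ⟩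
          occ e (fromMaybe (nth A′ j)) + occ e (take j A′)  ≡⟨ +-comm (occ e (fromMaybe (nth A′ j))) _ ⟩
          occ e (take j A′) + occ e (fromMaybe (nth A′ j))  ≡⟨ count-++ (e Fin.≟_) (take j A′) _ ⟨
          occ e (take j A′ ++ fromMaybe (nth A′ j))         ≡⟨ cong (occ e) (take-suc-nth A′ j) ⟨
          occ e (take (suc j) A′)                           ≡⟨ cong (λ i → occ e (take i A′)) (+-∸-assoc 1 D≤q) ⟨
          occ e (take (suc q ∸ D) A′)                       ∎
          where
          open ≡-Reasoning
          D≤q = ≮⇒≥ q≮D
          j = q ∸ D

      topExtra-absent : ∀ xs → ¬ Long xs → cnt x₀ (branch xs t) ≡ 0
      topExtra-absent xs ¬long =
        cnt-none (All.map (λ (_ , w≼a , h<w) → notTopColour w≼a h<w) (branch-vertices xs t))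
        where
        notTopColour : ∀ {w} → w ≼ xs ++ t → h < length w → colour w ≢ x₀
        notTopColour {w} w≼a h<w colour≡ with length w <? D
        ... | yes w<D = <-irrefl (sym (colourAt≡extra _ _ _ colour≡)) (∸-monoˡ-< J<offset k≤J)
          where
          J<offset : J < offset (length w)
          J<offset = subst (J <_) (sym (proj₂ (coordinates-between h<w w<D))) (m<m+n J (m<n⇒0<n∸m h<w))
        ... | no  w≮D = isElement (nth-< (member (takeLast D w)) j<length)
          where
          D≤w : D ≤ length w
          D≤w = ≮⇒≥ w≮D
          j<length : length w ∸ D < length (member (takeLast D w))
          j<length = +-cancelˡ-< D _ _ (begin-strict
            D + (length w ∸ D)                  ≡⟨ m+[n∸m]≡n D≤w ⟩
            length w                            ≤⟨ ≼⇒length≤ w≼a ⟩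
            length (xs ++ t)                    <⟨ ≰⇒> ¬long ⟩
            D + length (nextMember xs)          ≡⟨ cong (λ α → D + length (member α)) (takeLast-≼ w≼a D≤w) ⟨
            D + length (member (takeLast D w))  ∎)
            where open ≤-Reasoning
          w<D+s : length w < D + s
          w<D+s = subst (_< D + s) (m+[n∸m]≡n D≤w) (+-monoʳ-< D (<-≤-trans j<length (member-short _)))
          block≡ = proj₁ (coordinates-next D≤w w<D+s)
          offset≡ = proj₂ (coordinates-next D≤w w<D+s)
          isElement : (∃ λ e → nth (member (takeLast D w)) (length w ∸ D) ≡ just e) → ⊥
          isElement (e , nth≡e) = case trans (cong (colourAt (suc I) _) (sym nth≡e))
                                             (trans (sym (colour-at w block≡ offset≡)) colour≡) of λ ()

      -- Equal members force equal ancestors at level D: the address bits agree, and so does the part above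
      -- level I * s, which lies above t.  These ancestors contain the children of t the two branches pass through.
      nextMembers-distinct : ∀ xs ys → Diverge xs ys → D ≤ length (xs ++ t) → D ≤ length (ys ++ t) →
                             nextMember ys ≢ nextMember xs
      nextMembers-distinct xs ys diverge D≤a D≤b member≡
        with childTowards xs t (<-≤-trans h<D D≤a) | childTowards ys t (<-≤-trans h<D D≤b)
      ... | c , xs-ends , a≡ | c′ , ys-ends , b≡ = diverge xs-ends ys-ends (∷-injectiveˡ (begin
        c ∷ t                                    ≡⟨ a≡ ⟨
        takeLast (suc h) (xs ++ t)               ≡⟨ takeLast-takeLast (xs ++ t) h<D D≤a ⟨
        takeLast (suc h) (takeLast D (xs ++ t))  ≡⟨ cong (takeLast (suc h)) ancestors≡ ⟩
        takeLast (suc h) (takeLast D (ys ++ t))  ≡⟨ takeLast-takeLast (ys ++ t) h<D D≤b ⟩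
        takeLast (suc h) (ys ++ t)               ≡⟨ b≡ ⟩
        c′ ∷ t                                   ∎))
        where
        open ≡-Reasoning
        d≤D : d ≤ D
        d≤D = m≤m+n d (I * s)
        d≤length : ∀ zs → D ≤ length (zs ++ t) → d ≤ length (takeLast D (zs ++ t))
        d≤length zs D≤ = ≤-trans d≤D (≤-reflexive (sym (length-takeLast (zs ++ t) D≤)))
        upper : ∀ zs → D ≤ length (zs ++ t) → drop d (takeLast D (zs ++ t)) ≡ takeLast (I * s) t
        upper zs D≤ = trans (drop-takeLast (zs ++ t) d≤D D≤)
          (trans (cong (λ q → takeLast q (zs ++ t)) (m+n∸m≡n d (I * s))) (takeLast-++ zs t I*s≤h))
        ancestors≡ : takeLast D (xs ++ t) ≡ takeLast D (ys ++ t)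
        ancestors≡ = begin
          takeLast D (xs ++ t)                                            ≡⟨ take++drop≡id d _ ⟨
          take d (takeLast D (xs ++ t)) ++ drop d (takeLast D (xs ++ t))
            ≡⟨ cong₂ _++_ (member-injective _ _ (d≤length xs D≤a) (d≤length ys D≤b) (sym member≡))
                          (trans (upper xs D≤a) (sym (upper ys D≤b))) ⟩
          take d (takeLast D (ys ++ t)) ++ drop d (takeLast D (ys ++ t))  ≡⟨ take++drop≡id d _ ⟩
          takeLast D (ys ++ t)                                            ∎

      oneColour-long : ∀ xs ys → Diverge xs ys → Long xs → ∃ λ x → cntPath x t xs ys ≡ 1
      oneColour-long xs ys diverge long = element (suc I) e , (begin
        cnt x (branch xs t) + (cnt x (t ∷ []) + cnt x (branch ys t))
          ≡⟨ cong₂ _+_ xs-count (cong₂ _+_ top-count ys-count) ⟩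
        occ e Aₐ + (0 + occ e (take j Aᵦ))  ≡⟨ +-comm (occ e Aₐ) _ ⟩
        occ e (take j Aᵦ) + occ e Aₐ        ≡⟨ proj₂ odd ⟩
        1                                   ∎)
        where
        open ≡-Reasoning
        Aₐ Aᵦ : List (Fin n)
        Aₐ = nextMember xs
        Aᵦ = nextMember ys
        j : ℕ
        j = suc (length (ys ++ t)) ∸ D
        -- take j Aᵦ is the part of Aᵦ spelt out along the other branch.
        prefix≉ : ¬ SameSet (take j Aᵦ) Aₐ
        prefix≉ with D ≤? length (ys ++ t)
        ... | yes D≤b = F-psf Aᵦ Aₐ (member-∈ _) (member-∈ _)
                          (nextMembers-distinct xs ys diverge (≤-trans (m≤m+n D _) long) D≤b) j
        ... | no  D≰b = subst (λ i → ¬ SameSet (take i Aᵦ) Aₐ) (sym (m≤n⇒m∸n≡0 (≰⇒> D≰b)))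
                          (¬SameSet[]-member F-unique F-psf (≤-trans (^-monoʳ-≤ 2 1≤d) F-large) (member-∈ _))
        odd = occ-symmetricDifference (Unique.take⁺ j (member-unique _)) (member-unique _) prefix≉
        e : Fin n
        e = proj₁ odd
        x : Colour
        x = element (suc I) e
        |Aₐ|≤ : length Aₐ ≤ suc (length (xs ++ t)) ∸ D
        |Aₐ|≤ = ≤-trans (m+n≤o⇒m≤o∸n (length Aₐ) (subst (_≤ length (xs ++ t)) (+-comm D _) long))
                        (∸-monoˡ-≤ D (n≤1+n _))
        xs-count : cnt x (branch xs t) ≡ occ e Aₐ
        xs-count = trans (nextElement-count e _ xs (λ _ → refl)) (cong (occ e) (take-all _ Aₐ |Aₐ|≤))
        ys-count : cnt x (branch ys t) ≡ occ e (take j Aᵦ)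
        ys-count = nextElement-count e _ ys (λ _ → refl)
        top-count : cnt x (t ∷ []) ≡ 0
        top-count = cnt-none ((λ colour≡ → case trans (sym colour-top) colour≡ of λ ()) ∷ [])

      oneColour : ∀ xs ys → Diverge xs ys → ∃ λ x → cntPath x t xs ys ≡ 1
      oneColour xs ys diverge with D + length (nextMember xs) ≤? length (xs ++ t)
                                 | D + length (nextMember ys) ≤? length (ys ++ t)
      ... | yes long | _        = oneColour-long xs ys diverge long
      ... | no  _    | yes long = let x , once = oneColour-long ys xs (Diverge-sym diverge) long in
        x , trans (swap (cnt x (branch xs t)) (cnt x (t ∷ [])) (cnt x (branch ys t))) once
        where
        swap : ∀ a b c → a + (b + c) ≡ c + (b + a)
        swap = solve-∀
      ... | no ¬long | no ¬long′ = x₀ , cong₂ _+_ (topExtra-absent xs ¬long)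
                                          (cong₂ _+_ (cnt-[] colour-top) (topExtra-absent ys ¬long′))

    oneColour : ∀ xs ys → Diverge xs ys → ∃ λ x → cntPath x t xs ys ≡ 1
    oneColour xs ys diverge = byTopColour (nth A J) refl
      where
      byTopColour : ∀ m → nth A J ≡ m → ∃ λ x → cntPath x t xs ys ≡ 1
      byTopColour (just e) A[J]≡ = element I e , cong₂ _+_ (topElement-absent A[J]≡ xs)
                                     (cong₂ _+_ (cnt-[] (cong (colourAt I J) A[J]≡)) (topElement-absent A[J]≡ ys))
      byTopColour nothing  A[J]≡ = ExtraTop.oneColour A[J]≡ xs ys diverge

  oneColour-path : ∀ ws → IsPath Adjacent ws → ∃ λ x → cnt x ws ≡ 1
  oneColour-path ws path = x , (begin
    cnt x ws                                                        ≡⟨ cong (cnt x) shape ⟩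
    cnt x (branch xs top ++ (top ∷ []) ++ reverse (branch ys top))  ≡⟨ count-++ P? (branch xs top) _ ⟩
    cnt x (branch xs top) + cnt x ((top ∷ []) ++ reverse (branch ys top))
      ≡⟨ cong (cnt x (branch xs top) +_) (count-++ P? (top ∷ []) _) ⟩
    cnt x (branch xs top) + (cnt x (top ∷ []) + cnt x (reverse (branch ys top)))
      ≡⟨ cong (λ c → cnt x (branch xs top) + (cnt x (top ∷ []) + c)) (count-reverse P? (branch ys top)) ⟩
    cntPath x top xs ys                                             ≡⟨ once ⟩
    1                                                               ∎)
    where
    open PathShape (pathShape ws path)
    open ≡-Reasoning
    x = proj₁ (Top.oneColour top xs ys diverge)
    once = proj₂ (Top.oneColour top xs ys diverge)
    P? = λ w → colour w ≟ᶜ x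

  module Palette (r : ℕ) where

    levels colours : ℕ
    levels  = d * (r + 1) + k * r
    colours = n * r + d

    Valid : Colour → Set
    Valid (element i _) = 1 ≤ i × i ≤ r
    Valid (extra j)     = j < d

    colour-valid : ∀ w → length w < levels → Valid (colour w)
    colour-valid w w<levels = valid (block q) refl (s≤s⁻¹ block<)
      where
      q = length w
      block< : block q < suc r
      block< = m<n*o⇒m/o<n (subst (q + k <_) (levels+k d k r) (+-monoˡ-< k w<levels))
        where
        levels+k : ∀ d k r → d * (r + 1) + k * r + k ≡ suc r * (k + d)
        levels+k = solve-∀
      extra-valid : ∀ {i} → block q ≡ i → nth (blockSet i w) (offset q) ≡ nothing → offset q ∸ k < d
      extra-valid block≡ nth≡ =
        +-cancelˡ-< k _ d (subst (_< k + d) (sym (m+[n∸m]≡n (extra⇒k≤offset w block≡ nth≡))) (offset<s q))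
      valid : ∀ i → block q ≡ i → i ≤ r → Valid (colourAt i (offset q) (nth (blockSet i w) (offset q)))
      valid zero    block≡ _   = extra-valid block≡ refl
      valid (suc i) block≡ i≤r with nth (blockSet (suc i) w) (offset q) in nth≡
      ... | just _  = s≤s z≤n , i≤r
      ... | nothing = extra-valid block≡ nth≡

    index : (x : Colour) → .(Valid x) → Fin (n * r) ⊎ Fin d
    index (element i a) valid = inj₁ (combine a (fromℕ< (pred<r valid)))
      where
      pred<r : ∀ {i} → 1 ≤ i × i ≤ r → pred i < r
      pred<r (s≤s z≤n , i≤r) = i≤r
    index (extra j)     valid = inj₂ (fromℕ< valid)

    index-injective : ∀ x y (vx : Valid x) (vy : Valid y) → index x vx ≡ index y vy → x ≡ y
    index-injective (element (suc i) a) (element (suc i′) a′) (s≤s z≤n , _) (s≤s z≤n , _) eq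
      with combine-injective a _ a′ _ (inj₁-injective eq)
    ... | refl , fromℕ<≡ = cong (λ i → element (suc i) a) (fromℕ<-injective i i′ _ _ fromℕ<≡)
    index-injective (extra j) (extra j′) vx vy eq = cong extra (fromℕ<-injective j j′ vx vy (inj₂-injective eq))
    index-injective (element (suc _) _) (extra _) (s≤s z≤n , _) _ ()
    index-injective (extra _) (element (suc _) _) _ (s≤s z≤n , _) ()

    encode : (x : Colour) → .(Valid x) → Fin colours
    encode x valid = join (n * r) d (index x valid)

    encode-injective : ∀ x y (vx : Valid x) (vy : Valid y) → encode x vx ≡ encode y vy → x ≡ y
    encode-injective x y vx vy eq = index-injective x y vx vy (begin
      index x vx                   ≡⟨ splitAt-join (n * r) d _ ⟨
      splitAt (n * r) (encode x vx) ≡⟨ cong (splitAt (n * r)) eq ⟩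
      splitAt (n * r) (encode y vy) ≡⟨ splitAt-join (n * r) d _ ⟩
      index y vy                   ∎)
      where open ≡-Reasoning

    vertexColour : BVertex levels → Fin colours
    vertexColour (w , w<levels) = encode (colour w) (colour-valid w w<levels)

    vertexColour≡⇔colour≡ : ∀ u v → vertexColour u ≡ vertexColour v ⇔ colour (proj₁ u) ≡ colour (proj₁ v)
    vertexColour≡⇔colour≡ (u , u<) (v , v<) = mk⇔ (encode-injective _ _ (colour-valid u u<) (colour-valid v v<)) encode-cong
      where
      encode-cong : ∀ {x y} .{vx : Valid x} .{vy : Valid y} → x ≡ y → encode x vx ≡ encode y vy
      encode-cong refl = refl

    conflictFree : CF-B≤ levels colours
    conflictFree = vertexColour ,
      conflictFree-transport _≟ᶜ_ (λ v → colour (proj₁ v)) vertexColour vertexColour≡⇔colour≡ λ p path →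
        let x , once = oneColour-path (map proj₁ p) (wordPath path) in
        x , trans (sym (count-map (λ w → colour w ≟ᶜ x) proj₁ p)) once

B₀-conflictFree : ∀ c → CF-B≤ 0 c
B₀-conflictFree c = noColour , λ { [] (p≢[] , _) → ⊥-elim (p≢[] refl) ; ((_ , ()) ∷ _) _ }
  where
  noColour : BVertex 0 → Fin c
  noColour (_ , ())

-- The hypothesis 1 ≤ r is not needed; the case split only supplies the instance NonZero (k + d).
theorem6 : (k d n : ℕ) (F : List (List (Fin n))) →
    IsPSFFamily k d n F →
    All (λ A → length A ≤ k + d) F →
    (r : ℕ) → 1 ≤ r →
    CF-B≤ (d * (r + 1) + k * r) (n * r + d)
theorem6 zero    zero    n F _                                        _     r _ = B₀-conflictFree (n * r + 0)
theorem6 (suc k) d       n F (ordered , unique , psf , long , large) short r _ =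
  Construction.Palette.conflictFree (suc k) d n F ordered unique psf long short large r
theorem6 zero    (suc d) n F (ordered , unique , psf , long , large) short r _ =
  Construction.Palette.conflictFree zero (suc d) n F ordered unique psf long short large r
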